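{- For every integer $k\ge 2$, the graph $GP(4k,2k-1)$ admits a red-blue vertex coloring such that every connected component of the subgraph induced by the blue vertices is a single vertex or a single edge, and every connected component of the subgraph induced by the red vertices is a star with $1$, $2$ or $3$ edges. In particular, the blue induced subgraph has maximum degree at most $1$, and the red induced subgraph has minimum degree at least $1$ and contains no path with $3$ edges.
   Context: For $k\ge 2$, the graph $GP(4k,2k-1)$ has vertex set $\{u_1,\dots,u_{4k}\}\cup\{v_1,\dots,v_{4k}\}$ and edges: $u_iu_{i+1}$ for $1\le i\le 4k$ (the outer cycle), $u_iv_i$ for $1\le i\le 4k$ (spokes), and $v_iv_{i+2k-1}$ for $1\le i\le 4k$, with all indices taken modulo $4k$. A red-blue vertex coloring assigns each vertex one of the colors red or blue; components of a color class are the connected components of the subgraph induced by the vertices of that color. A star with $m$ edges is $K_{1,m}$. -}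

module Defs where

open import Data.Nat using (ℕ; _+_; _*_; _∸_; _≤_)
open import Data.Fin using (Fin; toℕ)
open import Data.Bool using (Bool; true; false)
open import Data.Product using (Σ; ∃; _×_; _,_)
open import Data.Sum using (_⊎_)
open import Relation.Binary.PropositionalEquality using (_≡_; _≢_)
open import Relation.Nullary using (¬_)
open import Function.Definitions using (Injective)

-- Vertices of a generalized Petersen graph GP(n,s):
-- (i , outer) is the outer vertex u_i, (i , inner) is the inner vertex v_i
-- (0-based indices i ∈ {0,…,n-1} instead of 1-based; a mere relabelling).
data Side : Set where
  outer inner : Side

Vertex : ℕ → Set
Vertex n = Fin n × Side

-- j ≡ i + d (mod n), for i j < n and d < n
_≡_+_mod_ : {n : ℕ} → Fin n → Fin n → ℕ → ℕ → Set
_≡_+_mod_ j i d n = (toℕ j ≡ toℕ i + d) ⊎ (toℕ j + n ≡ toℕ i + d)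

GPAdj : (n s : ℕ) → Vertex n → Vertex n → Set
GPAdj n s (i , outer) (j , outer) = (j ≡ i + 1 mod n) ⊎ (i ≡ j + 1 mod n)
GPAdj n s (i , outer) (j , inner) = i ≡ j
GPAdj n s (i , inner) (j , outer) = i ≡ j
GPAdj n s (i , inner) (j , inner) = (j ≡ i + s mod n) ⊎ (i ≡ j + s mod n)

data Colour : Set where
  red blue : Colour

module _ {V : Set} (Adj : V → V → Set) (col : V → Colour) where

  data Reach (c : Colour) : V → V → Set where
    here : ∀ {x} → col x ≡ c → Reach c x x
    step : ∀ {x y z} → col x ≡ c → Adj x y → Reach c y z → Reach c x z

  Component : V → V → Set
  Component v w = Reach (col v) v w

-- The subgraph of (V, Adj) induced by the vertex set S is a star K_{1,m}:
-- a centre c and m distinct leaves ℓ 0,…,ℓ (m-1), such that S consists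
-- exactly of c and the leaves, and two vertices of S are adjacent iff one
-- is the centre and the other a leaf.  (m = 0 : a single vertex;
-- m = 1 : a single edge.)
IsStar : {V : Set} → (V → V → Set) → (V → Set) → ℕ → Set
IsStar {V} Adj S m =
  Σ V λ c → Σ (Fin m → V) λ ℓ →
    Injective _≡_ _≡_ ℓ ×
    (∀ i → ℓ i ≢ c) ×
    (∀ x → (S x → (x ≡ c ⊎ ∃ λ i → x ≡ ℓ i)) × ((x ≡ c ⊎ ∃ λ i → x ≡ ℓ i) → S x)) ×
    (∀ x y → S x → S y →
       (Adj x y → ((x ≡ c × ∃ λ i → y ≡ ℓ i) ⊎ (y ≡ c × ∃ λ i → x ≡ ℓ i))) ×
       (((x ≡ c × ∃ λ i → y ≡ ℓ i) ⊎ (y ≡ c × ∃ λ i → x ≡ ℓ i)) → Adj x y))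

-- Colour u_i and v_i by the parity of i.  As n = 4k is even, the outer edges
-- u_i u_{i+1} (including the wrap-around edge) join indices of opposite parity,
-- and as s = 2k - 1 is odd, so do the inner edges v_i v_{i+s}.  Hence the only
-- monochromatic edges are the spokes u_i v_i, both colour classes induce perfect
-- matchings, and every component of either colour is a single edge K_{1,1}.
module Submission where

open import Defs
open import Data.Nat using (ℕ; suc; pred; parity; _+_; _*_; _∸_; _≤_; s≤s; z≤n)
open import Data.Nat.Properties using (suc-pred)
open import Data.Parity.Base as ℙ using (Parity; 0ℙ; 1ℙ; _⁻¹)
open import Data.Parity.Properties using (p≢p⁻¹; suc-homo-⁻¹; +-homo-+; *-homo-*)
  renaming (+-identityʳ to ℙ+-identityʳ; +-comm to ℙ+-comm)
open import Data.Fin using (Fin; toℕ; zero)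
open import Data.Product using (Σ; _×_; _,_)
open import Data.Sum using (_⊎_; inj₁; inj₂; map₂)
open import Data.Empty using (⊥-elim)
open import Relation.Nullary using (¬_)
open import Relation.Binary.PropositionalEquality
  using (_≡_; _≢_; refl; sym; trans; cong; subst; module ≡-Reasoning)

parity-2*suc∸1 : ∀ m → parity (2 * suc m ∸ 1) ≡ 1ℙ
parity-2*suc∸1 m = begin
  parity (2 * suc m ∸ 1)              ≡⟨ sym (suc-homo-⁻¹ (2 * suc m ∸ 1)) ⟩
  parity (suc (pred (2 * suc m))) ⁻¹  ≡⟨ cong (λ x → parity x ⁻¹) (suc-pred (2 * suc m)) ⟩
  parity (2 * suc m) ⁻¹               ≡⟨ cong _⁻¹ (*-homo-* 2 (suc m)) ⟩
  1ℙ                                  ∎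
  where open ≡-Reasoning

parity-+-mod : ∀ {n} {j : Fin n} i e → parity n ≡ 0ℙ →
               j ≡ i + e mod n → parity (toℕ j) ≡ parity (toℕ i) ℙ.+ parity e
parity-+-mod i e _ (inj₁ j≡i+e) = trans (cong parity j≡i+e) (+-homo-+ (toℕ i) e)
parity-+-mod {n} {j} i e n-even (inj₂ j+n≡i+e) = begin
  parity (toℕ j)                   ≡⟨ sym (ℙ+-identityʳ _) ⟩
  parity (toℕ j) ℙ.+ 0ℙ            ≡⟨ cong (parity (toℕ j) ℙ.+_) (sym n-even) ⟩
  parity (toℕ j) ℙ.+ parity n      ≡⟨ sym (+-homo-+ (toℕ j) n) ⟩
  parity (toℕ j + n)               ≡⟨ cong parity j+n≡i+e ⟩
  parity (toℕ i + e)               ≡⟨ +-homo-+ (toℕ i) e ⟩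
  parity (toℕ i) ℙ.+ parity e      ∎
  where open ≡-Reasoning

odd-step-flips-parity : ∀ {n} {j : Fin n} i e → parity n ≡ 0ℙ → parity e ≡ 1ℙ →
                        j ≡ i + e mod n → parity (toℕ j) ≡ parity (toℕ i) ⁻¹
odd-step-flips-parity i e n-even e-odd shift =
  trans (parity-+-mod i e n-even shift)
        (trans (cong (parity (toℕ i) ℙ.+_) e-odd) (ℙ+-comm (parity (toℕ i)) 1ℙ))

odd-edge-bichromatic : ∀ {n} {i j : Fin n} {e} → parity n ≡ 0ℙ → parity e ≡ 1ℙ →
                       (j ≡ i + e mod n) ⊎ (i ≡ j + e mod n) →
                       parity (toℕ i) ≢ parity (toℕ j)
odd-edge-bichromatic {i = i} {e = e} n-even e-odd (inj₁ shift) eq =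
  p≢p⁻¹ (parity (toℕ i)) (trans eq (odd-step-flips-parity i e n-even e-odd shift))
odd-edge-bichromatic {j = j} {e = e} n-even e-odd (inj₂ shift) eq =
  p≢p⁻¹ (parity (toℕ j)) (trans (sym eq) (odd-step-flips-parity j e n-even e-odd shift))

module MonochromaticMatching
  {V : Set} (Adj : V → V → Set) (col : V → Colour) (partner : V → V)
  (partner-involutive : ∀ x → partner (partner x) ≡ x)
  (partner-≢ : ∀ x → partner x ≢ x)
  (adj-partner : ∀ x → Adj x (partner x))
  (col-partner : ∀ x → col (partner x) ≡ col x)
  (monochromatic-edge : ∀ {x y} → col x ≡ col y → Adj x y → y ≡ partner x)
  where

  no-loop : ∀ x → ¬ Adj x x
  no-loop x loop = partner-≢ x (sym (monochromatic-edge refl loop))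

  reach-colour : ∀ {c y z} → Reach Adj col c y z → col y ≡ c
  reach-colour (here cy) = cy
  reach-colour (step cy _ _) = cy

  reach⇒≡-or-partner : ∀ {c x z} → Reach Adj col c x z → z ≡ x ⊎ z ≡ partner x
  reach⇒≡-or-partner (here _) = inj₁ refl
  reach⇒≡-or-partner {x = x} (step {y = y} cx x~y y⇝z)
    with monochromatic-edge (trans cx (sym (reach-colour y⇝z))) x~y | reach⇒≡-or-partner y⇝z
  ... | y≡x' | inj₁ z≡y  = inj₂ (trans z≡y y≡x')
  ... | y≡x' | inj₂ z≡y' = inj₁ (trans z≡y' (trans (cong partner y≡x') (partner-involutive x)))

  component-isEdge : ∀ v → IsStar Adj (Component Adj col v) 1
  component-isEdge v = v , (λ _ → partner v) , leaf-injective , (λ _ → partner-≢ v)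
                     , membership , adjacency
    where
    leaf-injective : ∀ {a b : Fin 1} → partner v ≡ partner v → a ≡ b
    leaf-injective {zero} {zero} _ = refl

    membership : ∀ x → (Component Adj col v x → x ≡ v ⊎ Σ (Fin 1) λ _ → x ≡ partner v)
                     × (x ≡ v ⊎ Σ (Fin 1) (λ _ → x ≡ partner v) → Component Adj col v x)
    membership x = (λ v⇝x → map₂ (zero ,_) (reach⇒≡-or-partner v⇝x))
                 , λ { (inj₁ refl) → here refl
                     ; (inj₂ (_ , refl)) → step refl (adj-partner v) (here (col-partner v)) }

    Centre–leaf : V → V → Set
    Centre–leaf x y = (x ≡ v × Σ (Fin 1) λ _ → y ≡ partner v)
                    ⊎ (y ≡ v × Σ (Fin 1) λ _ → x ≡ partner v)

    edge⇒centre–leaf : ∀ {x y} → x ≡ v ⊎ x ≡ partner v → y ≡ v ⊎ y ≡ partner v →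
                       Adj x y → Centre–leaf x y
    edge⇒centre–leaf {x} (inj₁ refl) (inj₁ refl) loop = ⊥-elim (no-loop x loop)
    edge⇒centre–leaf (inj₁ x≡v) (inj₂ y≡v') _ = inj₁ (x≡v , zero , y≡v')
    edge⇒centre–leaf (inj₂ x≡v') (inj₁ y≡v) _ = inj₂ (y≡v , zero , x≡v')
    edge⇒centre–leaf {x} (inj₂ refl) (inj₂ refl) loop = ⊥-elim (no-loop x loop)

    centre–leaf⇒edge : ∀ {x y} → Centre–leaf x y → Adj x y
    centre–leaf⇒edge (inj₁ (refl , _ , refl)) = adj-partner v
    centre–leaf⇒edge (inj₂ (refl , _ , refl)) =
      subst (Adj (partner v)) (partner-involutive v) (adj-partner (partner v))

    adjacency : ∀ x y → Component Adj col v x → Component Adj col v y →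
                (Adj x y → Centre–leaf x y) × (Centre–leaf x y → Adj x y)
    adjacency x y v⇝x v⇝y =
      edge⇒centre–leaf (reach⇒≡-or-partner v⇝x) (reach⇒≡-or-partner v⇝y) , centre–leaf⇒edge

colourOf : Parity → Colour
colourOf 0ℙ = red
colourOf 1ℙ = blue

colourOf-injective : ∀ {p q} → colourOf p ≡ colourOf q → p ≡ q
colourOf-injective {0ℙ} {0ℙ} _ = refl
colourOf-injective {1ℙ} {1ℙ} _ = refl

module ParityColouring (n s : ℕ) (n-even : parity n ≡ 0ℙ) (s-odd : parity s ≡ 1ℙ) where

  parityColouring : Vertex n → Colour
  parityColouring (i , _) = colourOf (parity (toℕ i))

  partner : Vertex n → Vertex n
  partner (i , outer) = i , inner
  partner (i , inner) = i , outer

  monochromatic-edge : ∀ {x y} → parityColouring x ≡ parityColouring y →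
                       GPAdj n s x y → y ≡ partner x
  monochromatic-edge {_ , outer} {_ , outer} same edge =
    ⊥-elim (odd-edge-bichromatic n-even refl edge (colourOf-injective same))
  monochromatic-edge {_ , outer} {_ , inner} _ refl = refl
  monochromatic-edge {_ , inner} {_ , outer} _ refl = refl
  monochromatic-edge {_ , inner} {_ , inner} same edge =
    ⊥-elim (odd-edge-bichromatic n-even s-odd edge (colourOf-injective same))

  partner-involutive : ∀ x → partner (partner x) ≡ x
  partner-involutive (_ , outer) = refl
  partner-involutive (_ , inner) = refl

  partner-≢ : ∀ x → partner x ≢ x
  partner-≢ (_ , outer) ()
  partner-≢ (_ , inner) ()

  spoke : ∀ x → GPAdj n s x (partner x)
  spoke (_ , outer) = refl
  spoke (_ , inner) = refl

  parityColouring-partner : ∀ x → parityColouring (partner x) ≡ parityColouring x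
  parityColouring-partner (_ , outer) = refl
  parityColouring-partner (_ , inner) = refl

  open MonochromaticMatching (GPAdj n s) parityColouring partner partner-involutive partner-≢
    spoke parityColouring-partner monochromatic-edge
    public using (component-isEdge)

mainTheorem2 : (k : ℕ) → 2 ≤ k →
    Σ (Vertex (4 * k) → Colour) λ col →
      (∀ v → col v ≡ blue →
         IsStar (GPAdj (4 * k) (2 * k ∸ 1)) (Component (GPAdj (4 * k) (2 * k ∸ 1)) col v) 0
         ⊎ IsStar (GPAdj (4 * k) (2 * k ∸ 1)) (Component (GPAdj (4 * k) (2 * k ∸ 1)) col v) 1)
      ×
      (∀ v → col v ≡ red →
         Σ ℕ λ m → 1 ≤ m × m ≤ 3 ×
           IsStar (GPAdj (4 * k) (2 * k ∸ 1)) (Component (GPAdj (4 * k) (2 * k ∸ 1)) col v) m)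
mainTheorem2 (suc k) (s≤s _) =
  parityColouring , (λ v _ → inj₂ (component-isEdge v))
                  , (λ v _ → 1 , s≤s z≤n , s≤s z≤n , component-isEdge v)
  where
  -- *-homo-* 4 m : parity (4 * m) ≡ 0ℙ ℙ.* parity m, and the right side reduces to 0ℙ.
  open ParityColouring (4 * suc k) (2 * suc k ∸ 1) (*-homo-* 4 (suc k)) (parity-2*suc∸1 k)
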